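{- Let $k\ge 2$ be an integer. Then the Andrásfai graph $\operatorname{And}(k)$ is not an open XOR-magic graph.
   Context: For $N\ge 3$ and a set $S$ of positive integers, the circulant graph $C_N(S)$ has vertices $x_0,\ldots,x_{N-1}$, with distinct $x_i,x_j$ adjacent iff $|i-j|\in\{s,\,N-s: s\in S\}$. For an integer $r\ge 2$, the Andrásfai graph is $\operatorname{And}(r)=C_{3r-1}(\{3k+1 : 0\le k\le \lfloor (3r-3)/2\rfloor\})$. For a vertex $x$, $N(x)$ is its set of neighbours. A simple connected graph $G=(V,E)$ is an open XOR-magic graph if $|V|=2^p$ for some positive integer $p$ and there is a bijection $\ell:V\to(\mathbb{Z}_2)^p$ with $\sum_{y\in N(x)}\ell(y)=0$ in $(\mathbb{Z}_2)^p$ for every $x\in V$. -}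

module Defs where

open import Data.Nat using (ℕ; zero; suc; _+_; _*_; _∸_; _^_; _≤_; ∣_-_∣)
open import Data.Nat.DivMod using (_/_)
import Data.Nat.Properties as ℕₚ
open import Data.Fin using (Fin; toℕ)
import Data.Fin.Properties as Finₚ
open import Data.Bool using (Bool; false; _xor_; if_then_else_)
open import Data.Vec using (Vec; replicate; zipWith)
open import Data.List using (List; map; upTo; foldr; allFin)
open import Data.List.Relation.Unary.Any using (Any; any?)
open import Data.Product using (Σ; _×_; _,_)
open import Data.Sum using (_⊎_)
open import Relation.Nullary using (Dec; does; ¬_)
open import Relation.Nullary.Decidable using (_×-dec_; _⊎-dec_; ¬?)
open import Relation.Binary.PropositionalEquality using (_≡_; _≢_)
open import Function.Bundles using (_⤖_; Bijection)

record Graph : Set₁ where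
  field
    order : ℕ
    Adj   : Fin order → Fin order → Set
    adj?  : ∀ x y → Dec (Adj x y)
open Graph public

-- Circulant graph C_N(S), S given as a list of positive integers.
-- x_i ~ x_j iff i ≠ j and |i-j| ∈ {s, N-s : s ∈ S}; "|i-j| = N - s" is
-- written |i-j| + s = N (integer subtraction, no truncation).
CircAdj : (N : ℕ) → List ℕ → Fin N → Fin N → Set
CircAdj N S i j =
  (i ≢ j) × Any (λ s → (∣ toℕ i - toℕ j ∣ ≡ s) ⊎ (∣ toℕ i - toℕ j ∣ + s ≡ N)) S

Circulant : ℕ → List ℕ → Graph
Circulant N S = record
  { order = N
  ; Adj   = CircAdj N S
  ; adj?  = λ i j → ¬? (i Finₚ.≟ j) ×-dec
                    any? (λ s → (∣ toℕ i - toℕ j ∣ ℕₚ.≟ s) ⊎-dec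
                                 ((∣ toℕ i - toℕ j ∣ + s) ℕₚ.≟ N)) S
  }

AndSet : ℕ → List ℕ
AndSet r = map (λ k → 3 * k + 1) (upTo (suc ((3 * r ∸ 3) / 2)))

And : ℕ → Graph
And r = Circulant (3 * r ∸ 1) (AndSet r)

-- (ℤ₂)^p as bit vectors with xor addition
zeroV : (p : ℕ) → Vec Bool p
zeroV p = replicate p false

_⊕_ : ∀ {p} → Vec Bool p → Vec Bool p → Vec Bool p
u ⊕ v = zipWith _xor_ u v

nbSum : (G : Graph) {p : ℕ} → (Fin (order G) → Vec Bool p) → Fin (order G) → Vec Bool p
nbSum G {p} ℓ x =
  foldr (λ y acc → if does (adj? G x y) then ℓ y ⊕ acc else acc) (zeroV p) (allFin (order G))

data Walk (G : Graph) : Fin (order G) → Fin (order G) → Set where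
  here : ∀ {x} → Walk G x x
  step : ∀ {x y z} → Adj G x y → Walk G y z → Walk G x z

Connected : Graph → Set
Connected G = ∀ x y → Walk G x y

Simple : Graph → Set
Simple G = (∀ x y → Adj G x y → Adj G y x) × (∀ x → ¬ Adj G x x)

OpenXORMagic : Graph → Set
OpenXORMagic G =
  Simple G × Connected G ×
  Σ ℕ λ p → (1 ≤ p) × (order G ≡ 2 ^ p) ×
    Σ (Fin (order G) ⤖ Vec Bool p) λ ℓ →
      ∀ x → nbSum G (Bijection.to ℓ) x ≡ zeroV p

{-# OPTIONS --safe #-}
-- Since N = 3k − 1 ≡ 2 (mod 3) and the connection set of And(k) contains every number
-- ≡ 1 (mod 3) below N and only such numbers, x_i ~ x_j iff |i − j| ≡ 1 (mod 3). Hence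
-- x₀ and x₃ have the same neighbours, except that x₁ is a neighbour of x₀ but not of x₃
-- and x₂ one of x₃ but not of x₀. Adding the two vanishing neighbourhood sums of a magic labelling ℓ leaves
-- ℓ(x₁) + ℓ(x₂) = 0, i.e. ℓ(x₁) = ℓ(x₂), contradicting injectivity.
module Submission where

open import Defs
open import Data.Nat using (ℕ; zero; suc; _≤_; _+_; _*_; _∸_; _<_; _%_; _/_; ∣_-_∣; _≟_; s≤s; s≤s⁻¹; z≤n)
open import Relation.Nullary using (¬_; does)

open import Level using (0ℓ)
open import Data.Nat.DivMod using (%-distribˡ-+; [m+kn]%n≡m%n; m≡m%n+[m/n]*n; m*n/n≡m; /-monoˡ-≤)
open import Data.Nat.Properties
  using (+-comm; *-comm; *-suc; *-cancelˡ-≤; *-monoˡ-≤; *-monoʳ-≤; ∸-monoˡ-≤; ≤-trans; ≤-<-trans;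
         <⇒≤; n≤1+n; ∣m-n∣≤m⊔n; ⊔-lub; ∣n-n∣≡0; module ≤-Reasoning)
open import Algebra.Bundles using (AbelianGroup)
open import Algebra.Structures using (IsAbelianGroup)
open import Data.Bool using (Bool; true; false; _xor_; if_then_else_)
open import Data.Bool.Properties
  using (xor-assoc; xor-comm; xor-identityˡ; xor-identityʳ; xor-same)
open import Data.Fin using (Fin; zero; suc; toℕ)
import Data.Fin.Properties as Fin
open import Data.List using (List; []; _∷_; foldr; map; allFin; upTo)
open import Data.List.Properties using (foldr-map; map-tabulate)
open import Data.List.Relation.Unary.Any using (Any)
open import Data.List.Membership.Propositional using (_∈_; find; lose)
open import Data.List.Membership.Propositional.Properties using (∈-map⁺; ∈-map⁻; ∈-upTo⁺)
open import Data.Product using (_,_)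
open import Data.Sum using (_⊎_; inj₁; inj₂)
open import Data.Vec using (Vec)
open import Data.Vec.Properties
  using (map-id; zipWith-assoc; zipWith-comm; zipWith-identityˡ; zipWith-identityʳ; zipWith-inverseˡ)
open import Function using (id; _∘_; _⇔_; mk⇔)
open import Function.Bundles using (Bijection)
open import Function.Definitions using (Injective)
open import Relation.Nullary.Decidable using (does-⇔)
open import Relation.Binary.PropositionalEquality

⊕-self : ∀ {p} (u : Vec Bool p) → u ⊕ u ≡ zeroV p
⊕-self u = trans (cong (_⊕ u) (sym (map-id u))) (zipWith-inverseˡ xor-same u)

⊕-isAbelianGroup : ∀ p → IsAbelianGroup _≡_ (_⊕_ {p}) (zeroV p) id
⊕-isAbelianGroup p = record
  { isGroup = record
    { isMonoid = record
      { isSemigroup = record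
        { isMagma  = record { isEquivalence = isEquivalence ; ∙-cong = cong₂ _⊕_ }
        ; assoc    = zipWith-assoc xor-assoc
        }
      ; identity = zipWith-identityˡ xor-identityˡ , zipWith-identityʳ xor-identityʳ
      }
    ; inverse = ⊕-self , ⊕-self
    ; ⁻¹-cong = id
    }
  ; comm = zipWith-comm xor-comm
  }

⊕-abelianGroup : ℕ → AbelianGroup 0ℓ 0ℓ
⊕-abelianGroup p = record { isAbelianGroup = ⊕-isAbelianGroup p }

module _ {p : ℕ} where
  open AbelianGroup (⊕-abelianGroup p) using (assoc; identityˡ; identityʳ; commutativeSemigroup)
  open import Algebra.Properties.AbelianGroup (⊕-abelianGroup p) using (x∙y⁻¹≈ε⇒x≈y)
  open import Algebra.Properties.CommutativeSemigroup commutativeSemigroup using (interchange; x∙yz≈y∙xz)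

  ⊕≡zero⇒≡ : (u w : Vec Bool p) → u ⊕ w ≡ zeroV p → u ≡ w
  ⊕≡zero⇒≡ = x∙y⁻¹≈ε⇒x≈y

  sumWhere : {A : Set} → (A → Bool) → (A → Vec Bool p) → List A → Vec Bool p
  sumWhere c v = foldr (λ y acc → if c y then v y ⊕ acc else acc) (zeroV p)

  sumWhere-xor : {A : Set} (c d : A → Bool) (v : A → Vec Bool p) (ys : List A) →
                 sumWhere c v ys ⊕ sumWhere d v ys ≡ sumWhere (λ y → c y xor d y) v ys
  sumWhere-xor c d v []       = identityˡ (zeroV p)
  sumWhere-xor c d v (y ∷ ys) with c y | d y
  ... | true  | true  = begin
    (v y ⊕ sumWhere c v ys) ⊕ (v y ⊕ sumWhere d v ys)  ≡⟨ interchange (v y) _ (v y) _ ⟩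
    (v y ⊕ v y) ⊕ (sumWhere c v ys ⊕ sumWhere d v ys)  ≡⟨ cong₂ _⊕_ (⊕-self (v y)) (sumWhere-xor c d v ys) ⟩
    zeroV p ⊕ _                                        ≡⟨ identityˡ _ ⟩
    _                                                  ∎
    where open ≡-Reasoning
  ... | true  | false = trans (assoc (v y) _ _) (cong (v y ⊕_) (sumWhere-xor c d v ys))
  ... | false | true  = trans (x∙yz≈y∙xz _ (v y) _) (cong (v y ⊕_) (sumWhere-xor c d v ys))
  ... | false | false = sumWhere-xor c d v ys

  sumWhere-cong : {A : Set} {c d : A → Bool} (v : A → Vec Bool p) (ys : List A) →
                  (∀ y → c y ≡ d y) → sumWhere c v ys ≡ sumWhere d v ys
  sumWhere-cong v []       c≗d = refl
  sumWhere-cong v (y ∷ ys) c≗d rewrite c≗d y | sumWhere-cong v ys c≗d = refl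

  sumWhere-none : {A : Set} (v : A → Vec Bool p) (ys : List A) →
                  sumWhere (λ _ → false) v ys ≡ zeroV p
  sumWhere-none v []       = refl
  sumWhere-none v (y ∷ ys) = sumWhere-none v ys

  sumWhere-map : {A B : Set} (c : B → Bool) (v : B → Vec Bool p) (f : A → B) (ys : List A) →
                 sumWhere c v (map f ys) ≡ sumWhere (c ∘ f) (v ∘ f) ys
  sumWhere-map c v f = foldr-map (λ y acc → if c y then v y ⊕ acc else acc) f (zeroV p)

  sumWhere-≟ : ∀ {n} (v : Fin n → Vec Bool p) (a : Fin n) →
               sumWhere (λ z → does (z Fin.≟ a)) v (allFin n) ≡ v a
  sumWhere-≟ {suc n} v a = begin
    sumWhere (λ z → does (z Fin.≟ a)) v (allFin (suc n))
      ≡⟨ cong (λ zs → sumWhere (λ z → does (z Fin.≟ a)) v (zero ∷ zs)) (sym (map-tabulate id suc)) ⟩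
    sumWhere (λ z → does (z Fin.≟ a)) v (zero ∷ map suc (allFin n))
      ≡⟨ split a ⟩
    v a ∎
    where
    open ≡-Reasoning
    split : ∀ a → sumWhere (λ z → does (z Fin.≟ a)) v (zero ∷ map suc (allFin n)) ≡ v a
    split zero    = begin
      v zero ⊕ sumWhere (λ z → does (z Fin.≟ zero)) v (map suc (allFin n))
        ≡⟨ cong (v zero ⊕_) (sumWhere-map (λ z → does (z Fin.≟ zero)) v suc (allFin n)) ⟩
      v zero ⊕ sumWhere (λ _ → false) (v ∘ suc) (allFin n)
        ≡⟨ cong (v zero ⊕_) (sumWhere-none (v ∘ suc) (allFin n)) ⟩
      v zero ⊕ zeroV p                           ≡⟨ identityʳ (v zero) ⟩
      v zero                                     ∎
    split (suc a) = trans (sumWhere-map (λ z → does (z Fin.≟ suc a)) v suc (allFin n))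
                          (sumWhere-≟ (v ∘ suc) a)

NbhdSymDiff : (G : Graph) (x y a b : Fin (order G)) → Set
NbhdSymDiff G x y a b =
  ∀ z → does (adj? G x z) xor does (adj? G y z) ≡ does (z Fin.≟ a) xor does (z Fin.≟ b)

nbSum-⊕ : (G : Graph) {p : ℕ} (ℓ : Fin (order G) → Vec Bool p) {x y a b : Fin (order G)} →
          NbhdSymDiff G x y a b → nbSum G ℓ x ⊕ nbSum G ℓ y ≡ ℓ a ⊕ ℓ b
nbSum-⊕ G ℓ {x} {y} {a} {b} Δ = begin
  nbSum G ℓ x ⊕ nbSum G ℓ y
    ≡⟨ sumWhere-xor (does ∘ adj? G x) (does ∘ adj? G y) ℓ (allFin (order G)) ⟩
  sumWhere (λ z → does (adj? G x z) xor does (adj? G y z)) ℓ (allFin (order G))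
    ≡⟨ sumWhere-cong ℓ (allFin (order G)) Δ ⟩
  sumWhere (λ z → does (z Fin.≟ a) xor does (z Fin.≟ b)) ℓ (allFin (order G))
    ≡⟨ sumWhere-xor (λ z → does (z Fin.≟ a)) (λ z → does (z Fin.≟ b)) ℓ (allFin (order G)) ⟨
  sumWhere (λ z → does (z Fin.≟ a)) ℓ (allFin (order G)) ⊕
  sumWhere (λ z → does (z Fin.≟ b)) ℓ (allFin (order G))
    ≡⟨ cong₂ _⊕_ (sumWhere-≟ ℓ a) (sumWhere-≟ ℓ b) ⟩
  ℓ a ⊕ ℓ b ∎
  where open ≡-Reasoning

xorMagic-nbhdSymDiff⇒≡ : (G : Graph) {p : ℕ} (ℓ : Fin (order G) → Vec Bool p) →
                         Injective _≡_ _≡_ ℓ → (∀ x → nbSum G ℓ x ≡ zeroV p) →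
                         {x y a b : Fin (order G)} → NbhdSymDiff G x y a b → a ≡ b
xorMagic-nbhdSymDiff⇒≡ G {p} ℓ ℓ-injective magic {x} {y} {a} {b} Δ =
  ℓ-injective (⊕≡zero⇒≡ (ℓ a) (ℓ b) (begin
    ℓ a ⊕ ℓ b                  ≡⟨ nbSum-⊕ G ℓ Δ ⟨
    nbSum G ℓ x ⊕ nbSum G ℓ y  ≡⟨ cong₂ _⊕_ (magic x) (magic y) ⟩
    zeroV p ⊕ zeroV p          ≡⟨ ⊕-self (zeroV p) ⟩
    zeroV p                    ∎))
  where open ≡-Reasoning

Mod3Circulant : (N : ℕ) → List ℕ → Set
Mod3Circulant N S = ∀ i j → CircAdj N S i j ⇔ ∣ toℕ i - toℕ j ∣ % 3 ≡ 1

[m+1]%3≡2⇒m%3≡1 : ∀ m → (m + 1) % 3 ≡ 2 → m % 3 ≡ 1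
[m+1]%3≡2⇒m%3≡1 0                   ()
[m+1]%3≡2⇒m%3≡1 1                   _ = refl
[m+1]%3≡2⇒m%3≡1 2                   ()
[m+1]%3≡2⇒m%3≡1 (suc (suc (suc m))) h = [m+1]%3≡2⇒m%3≡1 m h

circulant-mod3 : ∀ {N S} → N % 3 ≡ 2 → (∀ {s} → s ∈ S → s % 3 ≡ 1) →
                 (∀ {d} → d < N → d % 3 ≡ 1 → d ∈ S) → Mod3Circulant N S
circulant-mod3 {N} {S} N%3≡2 S-sound S-complete i j = mk⇔ (λ (_ , any) → isDistance⇒ any) ⇐
  where
  d = ∣ toℕ i - toℕ j ∣
  isDistance⇒ : Any (λ s → d ≡ s ⊎ d + s ≡ N) S → d % 3 ≡ 1
  isDistance⇒ any with find any
  ... | s , s∈S , inj₁ refl = S-sound s∈S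
  ... | s , s∈S , inj₂ d+s≡N = [m+1]%3≡2⇒m%3≡1 d (begin
    (d + 1) % 3              ≡⟨ %-distribˡ-+ d 1 3 ⟩
    (d % 3 + 1) % 3          ≡⟨ cong (λ t → (d % 3 + t) % 3) (S-sound s∈S) ⟨
    (d % 3 + s % 3) % 3      ≡⟨ %-distribˡ-+ d s 3 ⟨
    (d + s) % 3              ≡⟨ cong (_% 3) d+s≡N ⟩
    N % 3                    ≡⟨ N%3≡2 ⟩
    2                        ∎)
    where open ≡-Reasoning
  ⇐ : d % 3 ≡ 1 → CircAdj N S i j
  ⇐ d%3≡1 = i≢j , lose (S-complete d<N d%3≡1) (inj₁ refl)
    where
    d<N : d < N
    d<N = ≤-<-trans (∣m-n∣≤m⊔n (toℕ i) (toℕ j)) (⊔-lub (Fin.toℕ<n i) (Fin.toℕ<n j))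
    i≢j : i ≢ j
    i≢j refl with () ← trans (sym (cong (_% 3) (∣n-n∣≡0 (toℕ i)))) d%3≡1

mod3Circulant-nbhdSymDiff : ∀ {M S} → Mod3Circulant (4 + M) S →
                            NbhdSymDiff (Circulant (4 + M) S)
                                        zero (suc (suc (suc zero))) (suc zero) (suc (suc zero))
mod3Circulant-nbhdSymDiff {M} {S} mod3 z = begin
  does (adj? G x₀ z) xor does (adj? G x₃ z)
    ≡⟨ cong₂ _xor_ (does-⇔ (mod3 x₀ z) (adj? G x₀ z) (_ ≟ 1))
                   (does-⇔ (mod3 x₃ z) (adj? G x₃ z) (_ ≟ 1)) ⟩
  does (toℕ z % 3 ≟ 1) xor does (∣ 3 - toℕ z ∣ % 3 ≟ 1)
    ≡⟨ residues z ⟩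
  does (z Fin.≟ suc zero) xor does (z Fin.≟ suc (suc zero)) ∎
  where
  open ≡-Reasoning
  G = Circulant (4 + M) S
  x₀ x₃ : Fin (4 + M)
  x₀ = zero
  x₃ = suc (suc (suc zero))
  residues : ∀ z → does (toℕ z % 3 ≟ 1) xor does (∣ 3 - toℕ z ∣ % 3 ≟ 1) ≡
                   does (z Fin.≟ suc zero) xor does (z Fin.≟ suc (suc zero))
  -- for z = 3 + i both distances reduce to toℕ i by computation, also modulo 3
  residues zero                = refl
  residues (suc zero)          = refl
  residues (suc (suc zero))    = refl
  residues (suc (suc (suc i))) = xor-same (does (toℕ i % 3 ≟ 1))

mod3Circulant-¬xorMagic : ∀ {N S} → 3 < N → Mod3Circulant N S → ¬ OpenXORMagic (Circulant N S)
mod3Circulant-¬xorMagic {N} {S} (s≤s (s≤s (s≤s (s≤s _)))) mod3 (_ , _ , _ , _ , _ , ℓ , magic)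
  with () ← xorMagic-nbhdSymDiff⇒≡ (Circulant N S) (Bijection.to ℓ) (Bijection.injective ℓ) magic
              {x = zero} {y = suc (suc (suc zero))} {a = suc zero} {b = suc (suc zero)}
              (mod3Circulant-nbhdSymDiff mod3)

[m+3n]%3≡m%3 : ∀ m n → (m + 3 * n) % 3 ≡ m % 3
[m+3n]%3≡m%3 m n = trans (cong (λ t → (m + t) % 3) (*-comm 3 n)) ([m+kn]%n≡m%n m n 3)

m%3≡1⇒m≡3[m/3]+1 : ∀ m → m % 3 ≡ 1 → m ≡ 3 * (m / 3) + 1
m%3≡1⇒m≡3[m/3]+1 m m%3≡1 = begin
  m                  ≡⟨ m≡m%n+[m/n]*n m 3 ⟩
  m % 3 + m / 3 * 3  ≡⟨ cong (_+ m / 3 * 3) m%3≡1 ⟩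
  1 + m / 3 * 3      ≡⟨ +-comm 1 (m / 3 * 3) ⟩
  m / 3 * 3 + 1      ≡⟨ cong (_+ 1) (*-comm (m / 3) 3) ⟩
  3 * (m / 3) + 1    ∎
  where open ≡-Reasoning

3[1+r]∸1≡2+3r : ∀ r → 3 * suc r ∸ 1 ≡ 2 + 3 * r
3[1+r]∸1≡2+3r r = cong (_∸ 1) (*-suc 3 r)

3q+1<2+3r⇒q≤r : ∀ {q r} → 3 * q + 1 < 2 + 3 * r → q ≤ r
3q+1<2+3r⇒q≤r {q} {r} h = *-cancelˡ-≤ 3 (s≤s⁻¹ (begin
  1 + 3 * q  ≡⟨ +-comm 1 (3 * q) ⟩
  3 * q + 1  ≤⟨ s≤s⁻¹ h ⟩
  1 + 3 * r  ∎))
  where open ≤-Reasoning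

r≤3r/2 : ∀ r → r ≤ 3 * r / 2
r≤3r/2 r = begin
  r          ≡⟨ m*n/n≡m r 2 ⟨
  r * 2 / 2  ≤⟨ /-monoˡ-≤ 2 r*2≤3*r ⟩
  3 * r / 2  ∎
  where
  open ≤-Reasoning
  r*2≤3*r : r * 2 ≤ 3 * r
  r*2≤3*r = subst (_≤ 3 * r) (*-comm 2 r) (*-monoˡ-≤ r {2} {3} (s≤s (s≤s z≤n)))

And-mod3Circulant : ∀ {k} → 1 ≤ k → Mod3Circulant (3 * k ∸ 1) (AndSet k)
And-mod3Circulant {suc r} _ = circulant-mod3 N%3≡2 sound complete
  where
  bound : ℕ
  bound = (3 * suc r ∸ 3) / 2
  N%3≡2 : (3 * suc r ∸ 1) % 3 ≡ 2
  N%3≡2 = trans (cong (_% 3) (3[1+r]∸1≡2+3r r)) ([m+3n]%3≡m%3 2 r)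
  sound : ∀ {s} → s ∈ AndSet (suc r) → s % 3 ≡ 1
  sound s∈S with ∈-map⁻ (λ q → 3 * q + 1) {xs = upTo (suc bound)} s∈S
  ... | q , _ , refl = trans (cong (_% 3) (+-comm (3 * q) 1)) ([m+3n]%3≡m%3 1 q)
  complete : ∀ {d} → d < 3 * suc r ∸ 1 → d % 3 ≡ 1 → d ∈ AndSet (suc r)
  complete {d} d<N d%3≡1 =
    subst (_∈ AndSet (suc r)) (sym d≡3q+1) (∈-map⁺ (λ q → 3 * q + 1) (∈-upTo⁺ (s≤s q≤bound)))
    where
    d≡3q+1 : d ≡ 3 * (d / 3) + 1
    d≡3q+1 = m%3≡1⇒m≡3[m/3]+1 d d%3≡1
    q≤bound : d / 3 ≤ bound
    q≤bound = begin
      d / 3                    ≤⟨ 3q+1<2+3r⇒q≤r (subst₂ _<_ d≡3q+1 (3[1+r]∸1≡2+3r r) d<N) ⟩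
      r                        ≤⟨ r≤3r/2 r ⟩
      3 * r / 2                ≡⟨ cong (λ t → (t ∸ 3) / 2) (*-suc 3 r) ⟨
      (3 * suc r ∸ 3) / 2    ∎
      where open ≤-Reasoning

corollary6 : (k : ℕ) → 2 ≤ k → ¬ OpenXORMagic (And k)
corollary6 k 2≤k = mod3Circulant-¬xorMagic 3<N (And-mod3Circulant (<⇒≤ 2≤k))
  where
  3<N : 3 < 3 * k ∸ 1
  3<N = ≤-trans (n≤1+n 4) (∸-monoˡ-≤ 1 (*-monoʳ-≤ 3 2≤k))
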